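{- Let $Q$ be an ordered HDA and $\equiv$ a proper event identification on $Q$. Then for every rooted path $\pi$, the restriction of $\equiv$ to $S_\pi$ is trivial: if $a,b\in S_\pi$ and $a\equiv b$ then $a=b$.
   Context: Precubical sets: families of disjoint sets $Q_n$ with face maps $s_k,t_k:Q_n\to Q_{n-1}$ ($k=1,\dots,n$) satisfying $\alpha_k\beta_\ell=\beta_{\ell-1}\alpha_k$ for $\alpha,\beta\in\{s,t\}$, $k<\ell$. An HDA is a finite precubical set with initial cell $I\in Q_0$, assumed connected. Steps: $q'\xrightarrow{s_i}q$ with $s_iq=q'$, $q\xrightarrow{t_i}q'$ with $t_iq=q'$; paths are sequences of consecutive steps; rooted paths start at $I$. Universal labels: $\approx$ is the equivalence on $Q_1$ generated by $(s_iq,t_iq)$, $q\in Q_2$, $i\in\{1,2\}$; $\mathcal U(Q)=Q_1/\approx$, $\lambda(e)$ the class of $e$; $\lambda_i(q)=\lambda(s_1\cdots s_{i-1}s_{i+1}\cdots s_n(q))$ for $q\in Q_n$. $\lessdot$ is the transitive closure of $\{(\lambda(s_2q),\lambda(s_1q)):q\in Q_2\}$; $Q$ is ordered if there are no $a,b$ with $a\lessdot b$ and $b\lessdot a$. For rooted $\pi$: trivial path gives $(\emptyset,\emptyset)$; $\pi=\pi'\xrightarrow{s_i}q$ gives $S_\pi=S_{\pi'}\cup\{\lambda_i(q)\}$, $T_\pi=T_{\pi'}$; $\pi=\pi'\xrightarrow{t_i}t_i(q')$ with $q'$ the end of $\pi'$ gives $S_\pi=S_{\pi'}$, $T_\pi=T_{\pi'}\cup\{\lambda_i(q')\}$.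 A proper event identification is an equivalence $\equiv$ on $\mathcal U(Q)$ with: (i) if $a\lessdot b$, $c\lessdot d$, $a\equiv d$, $b\equiv c$ then $a\equiv b\equiv c\equiv d$; (ii) rooted paths with the same end cell have equal $(S_\pi/\!\equiv,T_\pi/\!\equiv)$; (iii) rooted paths with equal $(S_\pi/\!\equiv,T_\pi/\!\equiv)$ have the same end cell. ($A/\!\equiv$ is the set of classes of elements of $A$.) -}

module Defs where

open import Level using (0ℓ)
open import Data.Nat using (ℕ; zero; suc; _<_; _≤_; _≟_)
open import Data.Fin using (Fin; zero; suc; toℕ; inject₁; fromℕ; lower₁)
open import Data.Product using (Σ; Σ-syntax; ∃; _×_; _,_)
open import Data.List using (List; []; _∷_)
open import Data.List.Relation.Unary.Any using (Any)
open import Data.Empty using (⊥)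
open import Relation.Nullary using (¬_; Dec; yes; no)
open import Relation.Binary.Core using (Rel)
open import Relation.Binary.Structures using (IsEquivalence)
open import Relation.Binary.PropositionalEquality using (_≡_)
open import Relation.Binary.Construct.Closure.Equivalence using (EqClosure)
open import Relation.Binary.Construct.Closure.Transitive using (TransClosure)
open import Function.Bundles using (_↔_)

data Dir : Set where
  src tgt : Dir

-- Face indices are 0-based: the face map α_{k+1} : Q_{n+1} → Q_n
-- is  face α k  with  k : Fin (suc n).  Disjointness of the Q_n is automatic
-- (cells are indexed by their dimension).
record PrecubicalSet : Set₁ where
  field
    Cell : ℕ → Set
    face : ∀ {n} → Dir → Fin (suc n) → Cell (suc n) → Cell n
    -- α_k β_ℓ = β_{ℓ-1} α_k for k < ℓ  (here k 0-based, ℓ = suc ℓ' 0-based, k ≤ ℓ')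
    cubical : ∀ {n} (α β : Dir) (k ℓ' : Fin (suc n)) → toℕ k ≤ toℕ ℓ' →
              (x : Cell (suc (suc n))) →
              face α k (face β (suc ℓ') x) ≡ face β ℓ' (face α (inject₁ k) x)

  TCell : Set
  TCell = Σ ℕ Cell

  Adj : Rel TCell 0ℓ
  Adj (zero , _) _ = ⊥
  Adj (suc n , q) y = Σ Dir λ α → Σ (Fin (suc n)) λ i → y ≡ (n , face α i q)

record HDA : Set₁ where
  field
    P : PrecubicalSet
  open PrecubicalSet P public
  field
    finiteCells : ∀ n → Σ ℕ λ k → Cell n ↔ Fin k
    boundedDim  : Σ ℕ λ N → ∀ n → N < n → ¬ Cell n
    I : Cell 0
    connected : ∀ x → EqClosure Adj (0 , I) x

module HDATheory (Q : HDA) where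
  open HDA Q

  -- universal labels: U(Q) = Q₁/≈ ; labels are represented by edges, compared by ≈
  LabelGen : Rel (Cell 1) 0ℓ
  LabelGen e e' = Σ (Cell 2) λ q → Σ (Fin 2) λ i → face src i q ≡ e × face tgt i q ≡ e'

  _≈_ : Rel (Cell 1) 0ℓ
  _≈_ = EqClosure LabelGen

  -- λ_i(q) = λ(s_1 ⋯ s_{i-1} s_{i+1} ⋯ s_n q), given by a representative edge
  -- (i 0-based).  Rightmost face applied first: while the dimension m > 1, if i is
  -- not the last coordinate apply s_m, otherwise apply s_{m-1}.
  edgeAt : ∀ {n} → Fin (suc n) → Cell (suc n) → Cell 1
  edgeAt {zero} _ q = q
  edgeAt {suc n} i q = go (suc n ≟ toℕ i)
    where
    go : Dec (suc n ≡ toℕ i) → Cell 1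
    go (yes _) = edgeAt (fromℕ n) (face src (inject₁ (fromℕ n)) q)
    go (no ne) = edgeAt (lower₁ i ne) (face src (fromℕ (suc n)) q)

  -- the order ⋖ : transitive closure of (λ(s₂q), λ(s₁q)), q ∈ Q₂ (up to ≈)
  PrecBase : Rel (Cell 1) 0ℓ
  PrecBase a b = Σ (Cell 2) λ q → (a ≈ face src (suc zero) q) × (b ≈ face src zero q)

  _⋖_ : Rel (Cell 1) 0ℓ
  _⋖_ = TransClosure PrecBase

  Ordered : Set
  Ordered = ∀ a b → ¬ (a ⋖ b × b ⋖ a)

  -- paths: sequences of steps  q' --s_i--> q  (s_i q = q')  and  q --t_i--> t_i q
  data Path (x : TCell) : TCell → Set where
    []   : Path x x
    up   : ∀ {n} {q' : Cell n} → Path x (n , q') → (i : Fin (suc n)) →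
           (q : Cell (suc n)) → face src i q ≡ q' → Path x (suc n , q)
    down : ∀ {n} {q : Cell (suc n)} → Path x (suc n , q) → (i : Fin (suc n)) →
           Path x (n , face tgt i q)

  Root : TCell
  Root = (0 , I)

  Rooted : TCell → Set
  Rooted = Path Root

  -- S_π and T_π, as lists of representative edges of labels
  S : ∀ {x y} → Path x y → List (Cell 1)
  S []               = []
  S (up π i q _)     = edgeAt i q ∷ S π
  S (down π i)       = S π

  T : ∀ {x y} → Path x y → List (Cell 1)
  T []                        = []
  T (up π i q _)              = T π
  T (down {q = q} π i)        = edgeAt i q ∷ T π

  _∈ℓ_ : Cell 1 → List (Cell 1) → Set
  a ∈ℓ A = Any (a ≈_) A

  SameClasses : Rel (Cell 1) 0ℓ → List (Cell 1) → List (Cell 1) → Set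
  SameClasses E A B = (∀ a → a ∈ℓ A → Σ (Cell 1) λ b → b ∈ℓ B × E a b)
                    × (∀ b → b ∈ℓ B → Σ (Cell 1) λ a → a ∈ℓ A × E a b)

  -- an equivalence relation on U(Q): an equivalence on edges containing ≈
  record ProperEventIdentification : Set₁ where
    field
      _≡ₑ_     : Rel (Cell 1) 0ℓ
      isEquiv  : IsEquivalence _≡ₑ_
      resp≈    : ∀ {a b} → a ≈ b → a ≡ₑ b
      cond-i   : ∀ {a b c d} → a ⋖ b → c ⋖ d → a ≡ₑ d → b ≡ₑ c →
                 (a ≡ₑ b) × (b ≡ₑ c) × (c ≡ₑ d)
      cond-ii  : ∀ {x} (π π' : Rooted x) →
                 SameClasses _≡ₑ_ (S π) (S π') × SameClasses _≡ₑ_ (T π) (T π')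
      cond-iii : ∀ {x y} (π : Rooted x) (π' : Rooted y) →
                 SameClasses _≡ₑ_ (S π) (S π') → SameClasses _≡ₑ_ (T π) (T π') →
                 x ≡ y

module Submission where

-- Suppose a rooted path  π' = π --s_i--> q  starts a new event
-- c = λ_i(q) that is ≡-identified with some event d already started along π.
-- Then S_π' = S_π ∪ {c} and S_π have the same ≡-classes, and T_π' = T_π, so by
-- condition (iii) of a proper event identification π and π' end in the same
-- cell.  But an s-step raises the dimension by one, a contradiction: a newly
-- started event is never identified with an earlier one.  Distinct elements of
-- S_π were started by distinct s-steps of π, so by induction on π two
-- ≡-identified elements of S_π are started by the same step, i.e. carry the
-- same label.

open import Defs
open import Level using (0ℓ)
open import Data.Nat using (suc)
open import Data.Nat.Properties using (1+n≢n)
open import Data.Fin using (Fin)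
open import Data.Product using (Σ; _×_; _,_; proj₁)
open import Data.List using (List; _∷_)
open import Data.List.Relation.Unary.Any using (here; there)
open import Data.Empty using (⊥; ⊥-elim)
open import Relation.Binary.Core using (Rel)
open import Relation.Binary.Structures using (IsEquivalence)
open import Relation.Binary.PropositionalEquality using (_≡_; cong; sym)
import Relation.Binary.Construct.Closure.Equivalence as EqClosure

module Events (Q : HDA) where
  open HDA Q
  open HDATheory Q

  ≈-sym : ∀ {a b} → a ≈ b → b ≈ a
  ≈-sym = EqClosure.symmetric LabelGen

  ≈-trans : ∀ {a b c} → a ≈ b → b ≈ c → a ≈ c
  ≈-trans = EqClosure.transitive LabelGen

  module Classes {E : Rel (Cell 1) 0ℓ} (isEquiv : IsEquivalence E)
                 (resp≈ : ∀ {a b} → a ≈ b → E a b) where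
    open IsEquivalence isEquiv renaming (refl to E-refl; sym to E-sym; trans to E-trans)

    sameClasses-refl : (A : List (Cell 1)) → SameClasses E A A
    sameClasses-refl A = (λ a a∈A → a , a∈A , E-refl) , (λ a a∈A → a , a∈A , E-refl)

    sameClasses-redundant : ∀ {c d} (A : List (Cell 1)) → d ∈ℓ A → E c d →
                            SameClasses E A (c ∷ A)
    sameClasses-redundant {c} {d} A d∈A cEd = forth , back
      where
      forth : ∀ a → a ∈ℓ A → Σ (Cell 1) λ b → b ∈ℓ (c ∷ A) × E a b
      forth a a∈A = a , there a∈A , E-refl

      back : ∀ b → b ∈ℓ (c ∷ A) → Σ (Cell 1) λ a → a ∈ℓ A × E a b
      back b (here b≈c) = d , d∈A , E-sym (E-trans (resp≈ b≈c) cEd)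
      back b (there b∈A) = b , b∈A , E-refl

  module _ (PEI : ProperEventIdentification) where
    open ProperEventIdentification PEI
    open IsEquivalence isEquiv using () renaming (sym to ≡ₑ-sym; trans to ≡ₑ-trans)
    open Classes isEquiv resp≈

    -- An event started by the last s-step of a rooted path is not identified
    -- with any event started earlier: otherwise condition (iii) would force the
    -- path and its prefix to end in the same cell, though their dimensions differ.
    fresh : ∀ {n} {q' : Cell n} (π : Rooted (n , q')) (i : Fin (suc n))
            (q : Cell (suc n)) (s-face : face src i q ≡ q') →
            ∀ d → d ∈ℓ S π → edgeAt i q ≡ₑ d → ⊥
    fresh {n} {q'} π i q s-face d d∈Sπ new≡d = 1+n≢n (sym (cong proj₁ sameEnd))
      where
      sameEnd : (n , q') ≡ (suc n , q)
      sameEnd = cond-iii π (up π i q s-face)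
                  (sameClasses-redundant (S π) d∈Sπ new≡d)
                  (sameClasses-refl (T π))

    -- The event identification is injective on S_π (up to ≈): by induction on π,
    -- two identified events started by different steps contradict freshness.
    injective-on-S : ∀ {x} (π : Rooted x) → ∀ a b → a ∈ℓ S π → b ∈ℓ S π →
                     a ≡ₑ b → a ≈ b
    injective-on-S [] a b () _ _
    injective-on-S (down π i) a b a∈ b∈ a≡b = injective-on-S π a b a∈ b∈ a≡b
    injective-on-S (up π i q s-face) a b (here a≈c) (here b≈c) _ =
      ≈-trans a≈c (≈-sym b≈c)
    injective-on-S (up π i q s-face) a b (there a∈) (there b∈) a≡b =
      injective-on-S π a b a∈ b∈ a≡b
    injective-on-S (up π i q s-face) a b (here a≈c) (there b∈) a≡b =
      ⊥-elim (fresh π i q s-face b b∈ (≡ₑ-trans (≡ₑ-sym (resp≈ a≈c)) a≡b))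
    injective-on-S (up π i q s-face) a b (there a∈) (here b≈c) a≡b =
      ⊥-elim (fresh π i q s-face a a∈ (≡ₑ-trans (≡ₑ-sym (resp≈ b≈c)) (≡ₑ-sym a≡b)))

lemma4p21 : (Q : HDA) → HDATheory.Ordered Q →
            (E : HDATheory.ProperEventIdentification Q) →
            ∀ {x} (π : HDATheory.Rooted Q x) → ∀ a b →
            HDATheory._∈ℓ_ Q a (HDATheory.S Q π) → HDATheory._∈ℓ_ Q b (HDATheory.S Q π) →
            HDATheory.ProperEventIdentification._≡ₑ_ E a b → HDATheory._≈_ Q a b
lemma4p21 Q _ E = Events.injective-on-S Q E
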